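{- Let $V:\mathsf{Type}$ and $n\in\{ -1,0,1,2,\dots\}\cup\{\infty\}$. The type of $U$-like $\in$-structures $(V,\in)$ on $V$ such that $b\in a$ is an $n$-type for all $a,b:V$ is equivalent to the type of embeddings $V\hookrightarrow \mathsf{T}^{n+1}_U V$ (coalgebra structures which are embeddings).
   Context: Homotopy type theory with univalent universes $U:\mathsf{Type}$ and function extensionality; truncation levels extended by $\infty$ with $\infty\pm1=\infty$, every type being an $\infty$-type. An $\in$-structure on $V$ is a relation $\in:V\to V\to\mathsf{Type}$ which is extensional: for all $x,y:V$ the canonical map $(x=y)\to\prod_{z:V}(z\in x\simeq z\in y)$ (sending $\mathrm{refl}$ to the family of identity equivalences) is an equivalence. Write $\mathrm{El}\,a:=\sum_{x:V}x\in a$. The $\in$-structure is $U$-like if $\mathrm{El}\,a$ is essentially $U$-small (equivalent to some type in $U$) for every $a:V$. A map is $k$-truncated if all its homotopy fibers are $k$-types; $A\hookrightarrow_k X$ denotes the type of $k$-truncated maps, and $\mathsf{T}^{k+1}_U X:=\sum_{A:U}(A\hookrightarrow_k X)$. -}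

{-# OPTIONS --without-K #-}
module Defs where

open import Level using (Level; _⊔_) renaming (suc to lsuc)
open import Data.Product using (Σ; Σ-syntax; _×_; _,_; proj₁; proj₂)
open import Data.Unit.Polymorphic using (⊤)
open import Relation.Binary.PropositionalEquality using (_≡_; refl)
open import Axiom.Extensionality.Propositional using (Extensionality)

private
  variable
    a b : Level

isContr : Set a → Set a
isContr A = Σ[ c ∈ A ] ((x : A) → c ≡ x)

fiber : {A : Set a} {B : Set b} → (A → B) → B → Set (a ⊔ b)
fiber {A = A} f y = Σ[ x ∈ A ] (f x ≡ y)

isEquiv : {A : Set a} {B : Set b} → (A → B) → Set (a ⊔ b)
isEquiv {B = B} f = (y : B) → isContr (fiber f y)

_≃_ : Set a → Set b → Set (a ⊔ b)
A ≃ B = Σ[ f ∈ (A → B) ] isEquiv f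

infix 4 _≃_

idEquiv : (A : Set a) → A ≃ A
idEquiv A = (λ x → x) , λ y → (y , refl) , λ { (x , refl) → refl }

idtoeqv : {A B : Set a} → A ≡ B → A ≃ B
idtoeqv {A = A} refl = idEquiv A

Univalence : (ℓ : Level) → Set (lsuc ℓ)
Univalence ℓ = (A B : Set ℓ) → isEquiv (idtoeqv {A = A} {B = B})

data TLevel : Set where
  ⟨-2⟩ : TLevel
  S    : TLevel → TLevel
  ∞    : TLevel

⟨-1⟩ : TLevel
⟨-1⟩ = S ⟨-2⟩

_+1 : TLevel → TLevel
∞ +1 = ∞
n +1 = S n

isTrunc : TLevel → Set a → Set a
isTrunc ⟨-2⟩  A = isContr A
isTrunc (S k) A = (x y : A) → isTrunc k (x ≡ y)
isTrunc ∞     A = ⊤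

isTruncMap : TLevel → {A : Set a} {B : Set b} → (A → B) → Set (a ⊔ b)
isTruncMap k {B = B} f = (y : B) → isTrunc k (fiber f y)

_↪[_]_ : Set a → TLevel → Set b → Set (a ⊔ b)
A ↪[ k ] X = Σ[ f ∈ (A → X) ] isTruncMap k f

_↪_ : Set a → Set b → Set (a ⊔ b)
A ↪ X = A ↪[ ⟨-1⟩ ] X

-- T^{k+1}_U X := Σ (A : U) (A ↪_k X), where U = Set u.
-- (T⁺¹ u k X stands for T^{k+1}_U X.)
T⁺¹ : (u : Level) → TLevel → Set b → Set (lsuc u ⊔ b)
T⁺¹ u k X = Σ[ A ∈ Set u ] (A ↪[ k ] X)

module _ {v w : Level} {V : Set v} (_∈_ : V → V → Set w) where

  canonical : {x y : V} → x ≡ y → (z : V) → (z ∈ x) ≃ (z ∈ y)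
  canonical {x = x} refl z = idEquiv (z ∈ x)

  isExtensional : Set (v ⊔ w)
  isExtensional = (x y : V) → isEquiv (canonical {x = x} {y = y})

  El : V → Set (v ⊔ w)
  El a = Σ[ x ∈ V ] (x ∈ a)

isEssSmall : (u : Level) → Set a → Set (lsuc u ⊔ a)
isEssSmall u A = Σ[ B ∈ Set u ] (B ≃ A)

isULike : (u : Level) {v w : Level} {V : Set v} → (V → V → Set w) → Set (lsuc u ⊔ v ⊔ w)
isULike u {V = V} _∈_ = (a : V) → isEssSmall u (El _∈_ a)

InStr : (u : Level) {v : Level} (w : Level) (n : TLevel) (V : Set v) → Set (lsuc u ⊔ v ⊔ lsuc w)
InStr u w n V =
  Σ[ _∈_ ∈ (V → V → Set w) ]
    (isExtensional _∈_ × isULike u _∈_ × ((a b : V) → isTrunc n (b ∈ a)))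

{-# OPTIONS --without-K #-}
module Submission where

-- A coalgebra f : V → T^{n+1}_U V assigns to a the family of fibres b ↦ fib (f a) b,
-- and straightening identifies T^{n+1}_U V with the U-small families of n-types
-- over V; so coalgebras are the same as relations b ∈ a with U-small El a and
-- n-truncated membership.  By univalence a path f x = f y in T^{n+1}_U V is the
-- same as a fibrewise equivalence of these families, so the canonical map of
-- extensionality factors as cong f followed by an equivalence.  Hence ∈ is
-- extensional exactly when f is an embedding.

open import Defs
open import Level using (Level; _⊔_) renaming (suc to lsuc)
open import Relation.Binary.PropositionalEquality
  using (_≡_; _≢_; refl; sym; trans; cong; subst; trans-symˡ)
open import Axiom.Extensionality.Propositional using (Extensionality)
open import Data.Product using (Σ; Σ-syntax; _×_; _,_; proj₁; proj₂)
open import Function.Bundles using (mk↔ₛ′)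
import Function.Properties.Inverse.HalfAdjointEquivalence as HA

private
  variable
    a b c : Level

isProp : Set a → Set a
isProp A = (x y : A) → x ≡ y

isEmbedding : {A : Set a} {B : Set b} → (A → B) → Set (a ⊔ b)
isEmbedding = isTruncMap ⟨-1⟩

record Retract (A : Set a) (B : Set b) : Set (a ⊔ b) where
  constructor mkRetract
  field
    section    : A → B
    retraction : B → A
    retract    : (x : A) → retraction (section x) ≡ x

Retract-trans : {A : Set a} {B : Set b} {C : Set c} → Retract A B → Retract B C → Retract A C
Retract-trans (mkRetract s r rs) (mkRetract s′ r′ rs′) =
  mkRetract (λ x → s′ (s x)) (λ z → r (r′ z)) (λ x → trans (cong r (rs′ (s x))) (rs x))

Σ-Retract : {A : Set a} {P : A → Set b} {Q : A → Set c} →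
  ((x : A) → Retract (P x) (Q x)) → Retract (Σ A P) (Σ A Q)
Σ-Retract R = mkRetract (λ { (x , p) → x , Retract.section (R x) p })
                        (λ { (x , q) → x , Retract.retraction (R x) q })
                        (λ { (x , p) → cong (x ,_) (Retract.retract (R x) p) })

≡-sym-Retract : {A : Set a} {x y : A} → Retract (x ≡ y) (y ≡ x)
≡-sym-Retract = mkRetract sym sym λ { refl → refl }

record QInv {A : Set a} {B : Set b} (f : A → B) : Set (a ⊔ b) where
  constructor qinv
  field
    inv : B → A
    η   : (x : A) → inv (f x) ≡ x
    ε   : (y : B) → f (inv y) ≡ y

QInv⇒Retract : {A : Set a} {B : Set b} {f : A → B} → QInv f → Retract A B
QInv⇒Retract {f = f} (qinv g η ε) = mkRetract f g η

QInv⇒Retract⁻¹ : {A : Set a} {B : Set b} {f : A → B} → QInv f → Retract B A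
QInv⇒Retract⁻¹ {f = f} (qinv g η ε) = mkRetract g f ε

isEquiv⇒QInv : {A : Set a} {B : Set b} {f : A → B} → isEquiv f → QInv f
isEquiv⇒QInv {f = f} e = qinv (λ y → proj₁ (proj₁ (e y)))
  (λ x → cong proj₁ (proj₂ (e (f x)) (x , refl)))
  (λ y → proj₂ (proj₁ (e y)))

module HalfAdjoint {A : Set a} {B : Set b} (f : A → B) (q : QInv f) where
  open HA._≃_ (HA.↔⇒≃ (mk↔ₛ′ f (QInv.inv q) (QInv.ε q) (QInv.η q))) public
    using (from; left-inverse-of; right-inverse-of; left-right)

QInv⇒isEquiv : {A : Set a} {B : Set b} (f : A → B) → QInv f → isEquiv f
QInv⇒isEquiv f q y = (from y , right-inverse-of y) , centre-paths
  where
  open HalfAdjoint f q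
  fiber-≡ : ∀ {x x′} (r : x′ ≡ x) → _≡_ {A = fiber f (f x)} (x′ , cong f r) (x , refl)
  fiber-≡ refl = refl
  centre-paths : ∀ {y} (w : fiber f y) → (from y , right-inverse-of y) ≡ w
  centre-paths (x , refl) =
    trans (cong (from (f x) ,_) (sym (left-right x))) (fiber-≡ (left-inverse-of x))

-- Transport along the base of a Σ-type needs the half-adjoint coherence.
Σ-base-Retract : {A : Set a} {B : Set b} {f : A → B} (R : B → Set c) →
  QInv f → Retract (Σ[ x ∈ A ] R (f x)) (Σ B R)
Σ-base-Retract {A = A} {f = f} R q = mkRetract
  (λ { (x , r) → f x , r })
  (λ { (y , r) → from y , subst R (sym (right-inverse-of y)) r })
  (λ { (x , r) → trans (cong (λ p → from (f x) , subst R (sym p) r) (sym (left-right x)))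
                       (transport-back (left-inverse-of x) r) })
  where
  open HalfAdjoint f q
  transport-back : ∀ {x′ x} (p : x′ ≡ x) (r : R (f x)) →
    _≡_ {A = Σ[ x ∈ A ] R (f x)} (x′ , subst R (sym (cong f p)) r) (x , r)
  transport-back refl r = refl

isContr-retract : {A : Set a} {B : Set b} → Retract A B → isContr B → isContr A
isContr-retract (mkRetract s r rs) (c , h) = r c , λ x → trans (cong r (h (s x))) (rs x)

isContr-≡ : {A : Set a} → isContr A → (x y : A) → isContr (x ≡ y)
isContr-≡ (c , h) x y = trans (sym (h x)) (h y) , λ { refl → trans-symˡ (h x) }

isContr⇒isProp : {A : Set a} → isContr A → isProp A
isContr⇒isProp ch x y = proj₁ (isContr-≡ ch x y)

singleton-isContr : {A : Set a} (x : A) → isContr (Σ[ y ∈ A ] (x ≡ y))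
singleton-isContr x = (x , refl) , λ { (y , refl) → refl }

Σ-isContr : {A : Set a} {P : A → Set b} → isContr A → ((x : A) → isContr (P x)) →
  isContr (Σ A P)
Σ-isContr {P = P} (c , h) pc = (c , proj₁ (pc c)) , λ { (x , p) → along (h x) p }
  where
  along : ∀ {x} (e : c ≡ x) (p : P x) → (c , proj₁ (pc c)) ≡ (x , p)
  along refl p = cong (c ,_) (proj₂ (pc c) p)

Σ-prop-≡ : {A : Set a} (P : A → Set b) → ((x : A) → isProp (P x)) →
  {x y : A} → x ≡ y → (p : P x) (q : P y) → _≡_ {A = Σ A P} (x , p) (y , q)
Σ-prop-≡ P pp {x} refl p q = cong (x ,_) (pp x p q)

Σ-prop-isContr : {A : Set a} {P : A → Set b} → isContr A → ((x : A) → isProp (P x)) →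
  (x₀ : A) → P x₀ → isContr (Σ A P)
Σ-prop-isContr {P = P} (c , h) pp x₀ p₀ =
  (x₀ , p₀) , λ { (x , p) → Σ-prop-≡ P pp (trans (sym (h x₀)) (h x)) p₀ p }

module _ {A : Set a} {P : A → Set b} {x₀ : A} (φ : (y : A) → x₀ ≡ y → P y) where

  isContr-Σ⇒isEquiv : isContr (Σ A P) → (y : A) → isEquiv (φ y)
  isContr-Σ⇒isEquiv cP y p = isContr-retract fiber-retract
    (Σ-isContr (singleton-isContr x₀) λ { (y′ , q) → isContr-≡ cP (y′ , φ y′ q) (y , p) })
    where
    fiber-retract : Retract (fiber (φ y) p) (Σ[ d ∈ Σ A (x₀ ≡_) ] ((proj₁ d , φ (proj₁ d) (proj₂ d)) ≡ (y , p)))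
    fiber-retract = mkRetract (λ { (q , r) → (y , q) , cong (y ,_) r })
                              (λ { ((y′ , q) , refl) → q , refl })
                              (λ { (q , refl) → refl })

  isEquiv⇒isContr-Σ : ((y : A) → isEquiv (φ y)) → isContr (Σ A P)
  isEquiv⇒isContr-Σ eq =
    isContr-retract (Σ-Retract λ y → QInv⇒Retract⁻¹ (isEquiv⇒QInv (eq y))) (singleton-isContr x₀)

≡-Retract : {A : Set a} {B : Set b} (R : Retract A B) (x y : A) →
  Retract (x ≡ y) (Retract.section R x ≡ Retract.section R y)
≡-Retract (mkRetract s r rs) x y =
  mkRetract (cong s) (λ q → trans (sym (rs x)) (trans (cong r q) (rs y)))
            (λ { refl → trans-symˡ (rs x) })

isTrunc-retract : (k : TLevel) {A : Set a} {B : Set b} → Retract A B → isTrunc k B → isTrunc k A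
isTrunc-retract ⟨-2⟩  R t = isContr-retract R t
isTrunc-retract (S k) R t x y =
  isTrunc-retract k (≡-Retract R x y) (t (Retract.section R x) (Retract.section R y))
isTrunc-retract ∞     R t = _

module _ {A : Set a} {B : Set b} (f : A → B) where

  isEmbedding⇒isContr-Σ-≡ : isEmbedding f → (x : A) → isContr (Σ[ y ∈ A ] (f x ≡ f y))
  isEmbedding⇒isContr-Σ-≡ emb x = isContr-retract (Σ-Retract λ _ → ≡-sym-Retract)
    ((x , refl) , λ q → proj₁ (emb (f x) (x , refl) q))

  isContr-Σ-≡⇒isEmbedding : ((x : A) → isContr (Σ[ y ∈ A ] (f x ≡ f y))) → isEmbedding f
  isContr-Σ-≡⇒isEmbedding c .(f x) (x , refl) =
    isContr-≡ (isContr-retract (Σ-Retract λ _ → ≡-sym-Retract) (c x)) (x , refl)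

module FiberOverBase {A : Set a} (P : A → Set b) {C : Set c}
  (e : C → Σ A P) (e-equiv : isEquiv e) (y : A) where
  open HalfAdjoint e (isEquiv⇒QInv e-equiv)

  to : fiber (λ z → proj₁ (e z)) y → P y
  to (z , q) = subst P q (proj₂ (e z))

  QInv-to : QInv to
  QInv-to = qinv (λ p → from (y , p) , cong proj₁ (right-inverse-of (y , p)))
    (λ { (z , refl) → trans (cong (λ r → from (e z) , cong proj₁ r) (sym (left-right z)))
                            (fiber-≡ (left-inverse-of z)) })
    (λ p → subst-proj₂ (right-inverse-of (y , p)))
    where
    subst-proj₂ : ∀ {w} {p : P y} (r : w ≡ (y , p)) → subst P (cong proj₁ r) (proj₂ w) ≡ p
    subst-proj₂ refl = refl
    fiber-≡ : ∀ {z z′} (r : z′ ≡ z) →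
      _≡_ {A = fiber (λ z → proj₁ (e z)) (proj₁ (e z))} (z′ , cong proj₁ (cong e r)) (z , refl)
    fiber-≡ refl = refl

domain≃Σ-fiber : {A : Set a} {B : Set b} (g : A → B) → A ≃ Σ B (fiber g)
domain≃Σ-fiber g = (λ x → g x , x , refl) ,
  QInv⇒isEquiv _ (qinv (λ { (y , x , q) → x }) (λ x → refl) (λ { (y , x , refl) → refl }))

module WithFunExt (fe : (a b : Level) → Extensionality a b) where

  funext : {A : Set a} {B : A → Set b} {f g : (x : A) → B x} → ((x : A) → f x ≡ g x) → f ≡ g
  funext {a} {b} = fe a b

  Π-isProp : {A : Set a} {B : A → Set b} → ((x : A) → isProp (B x)) → isProp ((x : A) → B x)
  Π-isProp pp f g = funext λ x → pp x (f x) (g x)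

  Π-isContr : {A : Set a} {B : A → Set b} → ((x : A) → isContr (B x)) → isContr ((x : A) → B x)
  Π-isContr pc = (λ x → proj₁ (pc x)) , λ f → funext λ x → proj₂ (pc x) (f x)

  ×-isProp : {A : Set a} {B : Set b} → isProp A → isProp B → isProp (A × B)
  ×-isProp pa pb (x , y) (x′ , y′) = trans (cong (_, y) (pa x x′)) (cong (x′ ,_) (pb y y′))

  isContr-isProp : {A : Set a} → isProp (isContr A)
  isContr-isProp {A = A} (c , h) (c′ , h′) =
    Σ-prop-≡ (λ d → (x : A) → d ≡ x)
      (λ d → Π-isProp λ x → isContr⇒isProp (isContr-≡ (c , h) d x)) (h c′) h h′

  isTrunc-isProp : (k : TLevel) {A : Set a} → isProp (isTrunc k A)
  isTrunc-isProp ⟨-2⟩  = isContr-isProp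
  isTrunc-isProp (S k) = Π-isProp λ x → Π-isProp λ y → isTrunc-isProp k
  isTrunc-isProp ∞     _ _ = refl

  isEquiv-isProp : {A : Set a} {B : Set b} (f : A → B) → isProp (isEquiv f)
  isEquiv-isProp f = Π-isProp λ y → isContr-isProp

  isExtensional-isProp : {V : Set a} (_∈_ : V → V → Set b) → isProp (isExtensional _∈_)
  isExtensional-isProp _∈_ = Π-isProp λ x → Π-isProp λ y → isEquiv-isProp _

  ≃-≡ : {A : Set a} {B : Set b} (e e′ : A ≃ B) → proj₁ e ≡ proj₁ e′ → e ≡ e′
  ≃-≡ e e′ p = Σ-prop-≡ isEquiv isEquiv-isProp p (proj₂ e) (proj₂ e′)

  ≃-∘ : {A : Set a} {B : Set b} {C : Set c} → B ≃ C → A ≃ B → A ≃ C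
  ≃-∘ (f₁ , e₁) (f₂ , e₂) = (λ x → f₁ (f₂ x)) , QInv⇒isEquiv _ (qinv (λ z → g₂ (g₁ z))
      (λ x → trans (cong g₂ (η₁ (f₂ x))) (η₂ x))
      (λ z → trans (cong f₁ (ε₂ (g₁ z))) (ε₁ z)))
    where
    open QInv (isEquiv⇒QInv e₁) renaming (inv to g₁; η to η₁; ε to ε₁)
    open QInv (isEquiv⇒QInv e₂) renaming (inv to g₂; η to η₂; ε to ε₂)

  ≃-sym : {A : Set a} {B : Set b} → A ≃ B → B ≃ A
  ≃-sym (f , e) = inv , QInv⇒isEquiv inv (qinv f ε η)
    where open QInv (isEquiv⇒QInv e)

  isEssSmall-isProp : (u : Level) → Univalence u → {X : Set a} → isProp (isEssSmall u X)
  isEssSmall-isProp u ua {X} (B₀ , e₀) = isContr⇒isProp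
      (isContr-retract (Retract-trans to-B₀ to-paths) (singleton-isContr B₀)) (B₀ , e₀)
    where
    to-B₀ : Retract (Σ[ B ∈ Set u ] (B ≃ X)) (Σ[ B ∈ Set u ] (B ≃ B₀))
    to-B₀ = Σ-Retract λ B → mkRetract (≃-∘ (≃-sym e₀)) (≃-∘ e₀)
      (λ d → ≃-≡ _ d (funext λ x → QInv.ε (isEquiv⇒QInv (proj₂ e₀)) (proj₁ d x)))
    to-paths : Retract (Σ[ B ∈ Set u ] (B ≃ B₀)) (Σ[ B ∈ Set u ] (B₀ ≡ B))
    to-paths = Σ-Retract λ B → Retract-trans (QInv⇒Retract⁻¹ (isEquiv⇒QInv (ua B B₀))) ≡-sym-Retract

  fiberwise-≃-singleton : Univalence b → {A : Set a} (P : A → Set b) →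
    isContr (Σ[ Q ∈ (A → Set b) ] ((x : A) → P x ≃ Q x))
  fiberwise-≃-singleton ua P = isContr-retract
    (mkRetract (λ { (Q , e) x → Q x , e x }) (λ g → (λ x → proj₁ (g x)) , (λ x → proj₂ (g x)))
               (λ _ → refl))
    (Π-isContr λ x → isEquiv⇒isContr-Σ (λ Q → idtoeqv {A = P x} {B = Q}) (ua (P x)))

module Coalgebras {u v : Level} (uaU : Univalence u) (uaW : Univalence (lsuc u ⊔ v))
  (fe : (a b : Level) → Extensionality a b) (V : Set (lsuc u ⊔ v)) (n : TLevel) where
  open WithFunExt fe

  ℓ : Level
  ℓ = lsuc u ⊔ v

  T : Set ℓ
  T = T⁺¹ u n V

  isSmallTruncFam : (V → Set ℓ) → Set ℓ
  isSmallTruncFam P = isEssSmall u (Σ V P) × ((b : V) → isTrunc n (P b))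

  isSmallTruncFam-isProp : (P : V → Set ℓ) → isProp (isSmallTruncFam P)
  isSmallTruncFam-isProp P = ×-isProp (isEssSmall-isProp u uaU) (Π-isProp λ b → isTrunc-isProp n)

  SmallTruncFam : Set (lsuc ℓ)
  SmallTruncFam = Σ (V → Set ℓ) isSmallTruncFam

  ua : {A B : Set ℓ} → A ≃ B → A ≡ B
  ua {A} {B} e = proj₁ (proj₁ (uaW A B e))

  fibers : T → SmallTruncFam
  fibers (A , g , g-trunc) = fiber g , (A , domain≃Σ-fiber g) , g-trunc

  total : SmallTruncFam → T
  total (P , (B , e , e-equiv) , P-trunc) = B , (λ z → proj₁ (e z)) , λ y →
    isTrunc-retract n (QInv⇒Retract (FiberOverBase.QInv-to P e e-equiv y)) (P-trunc y)

  total-fibers : (t : T) → total (fibers t) ≡ t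
  total-fibers (A , g , g-trunc) =
    cong (λ q → A , g , q) (Π-isProp (λ y → isTrunc-isProp n) _ g-trunc)

  fibers-total : (P : SmallTruncFam) → fibers (total P) ≡ P
  fibers-total (P , (B , e , e-equiv) , P-trunc) = Σ-prop-≡ isSmallTruncFam isSmallTruncFam-isProp
    (funext λ y → ua (_ , QInv⇒isEquiv _ (FiberOverBase.QInv-to P e e-equiv y))) _ _

  fibers-QInv : QInv fibers
  fibers-QInv = qinv total total-fibers fibers-total

  fib : T → V → Set ℓ
  fib t = proj₁ (fibers t)

  ≡⇒fib≃ : {t t′ : T} → t ≡ t′ → (z : V) → fib t z ≃ fib t′ z
  ≡⇒fib≃ {t} refl z = idEquiv (fib t z)

  ≡⇒fib≃-isEquiv : (t t′ : T) → isEquiv (≡⇒fib≃ {t} {t′})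
  ≡⇒fib≃-isEquiv t = isContr-Σ⇒isEquiv (λ t′ → ≡⇒fib≃ {t} {t′})
    (isContr-retract (Σ-base-Retract (λ P → (z : V) → fib t z ≃ proj₁ P z) fibers-QInv)
      (isContr-retract reassociate
        (Σ-prop-isContr (fiberwise-≃-singleton uaW (fib t)) (λ P → isSmallTruncFam-isProp (proj₁ P))
          (fib t , λ z → idEquiv (fib t z)) (proj₂ (fibers t)))))
    where
    reassociate : Retract (Σ[ P ∈ SmallTruncFam ] ((z : V) → fib t z ≃ proj₁ P z))
                          (Σ[ Pe ∈ Σ[ P ∈ (V → Set ℓ) ] ((z : V) → fib t z ≃ P z) ]
                             isSmallTruncFam (proj₁ Pe))
    reassociate = mkRetract (λ { ((P , s) , e) → (P , e) , s }) (λ { ((P , e) , s) → (P , s) , e })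
                            (λ _ → refl)

  membership : (V → T) → V → V → Set ℓ
  membership f b a = fib (f a) b

  module _ (f : V → T) where

    Σ-≡-Retract : (x : V) →
      Retract (Σ[ y ∈ V ] (f x ≡ f y)) (Σ[ y ∈ V ] ((z : V) → fib (f x) z ≃ fib (f y) z))
    Σ-≡-Retract x = Σ-Retract λ y → QInv⇒Retract (isEquiv⇒QInv (≡⇒fib≃-isEquiv (f x) (f y)))

    Σ-≡-Retract⁻¹ : (x : V) →
      Retract (Σ[ y ∈ V ] ((z : V) → fib (f x) z ≃ fib (f y) z)) (Σ[ y ∈ V ] (f x ≡ f y))
    Σ-≡-Retract⁻¹ x = Σ-Retract λ y → QInv⇒Retract⁻¹ (isEquiv⇒QInv (≡⇒fib≃-isEquiv (f x) (f y)))

    isExtensional⇒isEmbedding : isExtensional (membership f) → isEmbedding f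
    isExtensional⇒isEmbedding ext = isContr-Σ-≡⇒isEmbedding f λ x →
      isContr-retract (Σ-≡-Retract x) (isEquiv⇒isContr-Σ (λ y → canonical (membership f)) (ext x))

    isEmbedding⇒isExtensional : isEmbedding f → isExtensional (membership f)
    isEmbedding⇒isExtensional emb x = isContr-Σ⇒isEquiv (λ y → canonical (membership f))
      (isContr-retract (Σ-≡-Retract⁻¹ x) (isEmbedding⇒isContr-Σ-≡ f emb x))

  familyOf : InStr u ℓ n V → V → SmallTruncFam
  familyOf (_∈_ , ext , small , trunc) a = (λ b → b ∈ a) , small a , trunc a

  InStr→Embedding : InStr u ℓ n V → V ↪ T
  InStr→Embedding s@(_∈_ , ext , _) = f , isExtensional⇒isEmbedding f (subst isExtensional same-∈ ext)
    where
    f : V → T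
    f a = total (familyOf s a)
    same-∈ : _∈_ ≡ membership f
    same-∈ = sym (funext λ b → funext λ a → cong (λ P → proj₁ P b) (fibers-total (familyOf s a)))

  Embedding→InStr : V ↪ T → InStr u ℓ n V
  Embedding→InStr (f , emb) =
    membership f , isEmbedding⇒isExtensional f emb ,
    (λ a → proj₁ (proj₂ (fibers (f a)))) , (λ a → proj₂ (proj₂ (fibers (f a))))

  Embedding→InStr→Embedding : (e : V ↪ T) → InStr→Embedding (Embedding→InStr e) ≡ e
  Embedding→InStr→Embedding (f , emb) =
    Σ-prop-≡ isEmbedding (λ g → Π-isProp λ t → isTrunc-isProp ⟨-1⟩)
      (funext λ a → total-fibers (f a)) _ emb

  InStr→Embedding→InStr : (s : InStr u ℓ n V) → Embedding→InStr (InStr→Embedding s) ≡ s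
  InStr→Embedding→InStr s@(_∈_ , ext , _) =
    along (funext λ a → fibers-total (familyOf s a)) _ ext
    where
    toInStr : (h : V → SmallTruncFam) → isExtensional (λ b a → proj₁ (h a) b) → InStr u ℓ n V
    toInStr h ext = (λ b a → proj₁ (h a) b) , ext ,
      (λ a → proj₁ (proj₂ (h a))) , (λ a → proj₂ (proj₂ (h a)))
    along : {h h′ : V → SmallTruncFam} → h ≡ h′ → (ext : _) (ext′ : _) → toInStr h ext ≡ toInStr h′ ext′
    along {h} refl ext ext′ = cong (toInStr h) (isExtensional-isProp _ ext ext′)

  InStr≃Embedding : InStr u ℓ n V ≃ (V ↪ T)
  InStr≃Embedding = InStr→Embedding ,
    QInv⇒isEquiv InStr→Embedding (qinv Embedding→InStr InStr→Embedding→InStr Embedding→InStr→Embedding)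

-- The construction works at every level.
mainTheorem3 : {u v : Level} → Univalence u → Univalence (lsuc u ⊔ v)
    → ((a b : Level) → Extensionality a b)
    → (V : Set (lsuc u ⊔ v)) (n : TLevel) → n ≢ ⟨-2⟩
    → InStr u (lsuc u ⊔ v) n V ≃ (V ↪ T⁺¹ u n V)
mainTheorem3 {u} {v} uaU uaW fe V n _ = Coalgebras.InStr≃Embedding {u} {v} uaU uaW fe V n
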